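{- Let $D$ be an oriented graph on $n\ge 2$ vertices. If $u,v\in V(D)$ are twin vertices, then $\mathrm{inv}(D-v)=\mathrm{inv}(D)$.
   Context: An oriented graph is a simple directed graph with no loops and at most one of the edges $uv$, $vu$ for each pair of distinct vertices. $N^+(x)$ and $N^-(x)$ denote the out- and in-neighbourhoods of $x$. Vertices $u,v$ are twins if $N^+(u)\setminus\{v\}=N^+(v)\setminus\{u\}$ and $N^-(u)\setminus\{v\}=N^-(v)\setminus\{u\}$. For $X\subseteq V(D)$, inverting $X$ means reversing the orientation of every edge with both endpoints in $X$. The inversion number $\mathrm{inv}(D)$ is the minimum number of sets whose successive inversion yields an acyclic oriented graph. -}

module Defs where

open import Data.Nat using (ℕ; zero; suc; _≤_)
open import Data.Fin using (Fin; punchIn)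
open import Data.Bool using (Bool; true; false; _∧_; if_then_else_)
open import Data.Vec using (Vec; []; _∷_)
open import Data.Product using (Σ; _×_; _,_)
open import Relation.Nullary using (¬_)
open import Relation.Binary.PropositionalEquality using (_≡_; _≢_)
open import Relation.Binary.Construct.Closure.Transitive using (TransClosure)
open import Function.Bundles using (_⇔_)

record OrientedGraph (n : ℕ) : Set where
  field
    adj    : Fin n → Fin n → Bool
    irrefl : ∀ x → adj x x ≡ false
    asym   : ∀ x y → adj x y ≡ true → adj y x ≡ false
open OrientedGraph public

Arc : ∀ {n} → OrientedGraph n → Fin n → Fin n → Set
Arc D x y = adj D x y ≡ true

Subset : ℕ → Set
Subset n = Fin n → Bool

invertAdj : ∀ {n} → (Fin n → Fin n → Bool) → Subset n → Fin n → Fin n → Bool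
invertAdj a X x y = if X x ∧ X y then a y x else a x y

private
  inv-irrefl : ∀ {n} (D : OrientedGraph n) (X : Subset n) (x : Fin n) →
               invertAdj (adj D) X x x ≡ false
  inv-irrefl D X x with X x ∧ X x
  ... | true  = irrefl D x
  ... | false = irrefl D x

  inv-asym : ∀ {n} (D : OrientedGraph n) (X : Subset n) (x y : Fin n) →
             invertAdj (adj D) X x y ≡ true → invertAdj (adj D) X y x ≡ false
  inv-asym D X x y p with X x | X y
  ... | true  | true  = asym D y x p
  ... | true  | false = asym D x y p
  ... | false | true  = asym D x y p
  ... | false | false = asym D x y p

invert : ∀ {n} → OrientedGraph n → Subset n → OrientedGraph n
invert D X = record
  { adj = invertAdj (adj D) X ; irrefl = inv-irrefl D X ; asym = inv-asym D X }

invertAll : ∀ {n k} → OrientedGraph n → Vec (Subset n) k → OrientedGraph n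
invertAll D []       = D
invertAll D (X ∷ Xs) = invertAll (invert D X) Xs

Acyclic : ∀ {n} → OrientedGraph n → Set
Acyclic D = ∀ x → ¬ TransClosure (Arc D) x x

InvertibleWith : ∀ {n} → OrientedGraph n → ℕ → Set
InvertibleWith {n} D k = Σ (Vec (Subset n) k) (λ Xs → Acyclic (invertAll D Xs))

IsInversionNumber : ∀ {n} → OrientedGraph n → ℕ → Set
IsInversionNumber D k = InvertibleWith D k × (∀ j → InvertibleWith D j → k ≤ j)

private
  del-irrefl : ∀ {n} (D : OrientedGraph (suc n)) (v : Fin (suc n)) (x : Fin n) →
               adj D (punchIn v x) (punchIn v x) ≡ false
  del-irrefl D v x = irrefl D (punchIn v x)

deleteVertex : ∀ {n} → OrientedGraph (suc n) → Fin (suc n) → OrientedGraph n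
deleteVertex D v = record
  { adj    = λ x y → adj D (punchIn v x) (punchIn v y)
  ; irrefl = del-irrefl D v
  ; asym   = λ x y → asym D (punchIn v x) (punchIn v y) }

Twins : ∀ {n} → OrientedGraph n → Fin n → Fin n → Set
Twins D u v =
  u ≢ v ×
  (∀ w → (Arc D u w × w ≢ v) ⇔ (Arc D v w × w ≢ u)) ×
  (∀ w → (Arc D w u × w ≢ v) ⇔ (Arc D w v × w ≢ u))

-- Deleting a vertex never increases the inversion number: restrict the inverted sets. Conversely,
-- given sets making D − v acyclic, put v into exactly those sets that contain its twin u. After
-- inverting, u and v are still twins and deleting v leaves an acyclic graph. Identifying v with u
-- maps every cycle to a closed walk of D − v: an arc between u and v is contracted, and two
-- consecutive arcs cannot both be contracted since that would need a 2-cycle on {u, v}.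
module Submission where

open import Defs
open import Data.Nat using (ℕ; suc; _≤_)
open import Data.Fin using (Fin; punchIn; punchOut)
open import Data.Fin.Properties
  using (_≟_; punchIn-punchOut; punchOut-punchIn; punchOut-cong; punchOut-injective; punchInᵢ≢i)
open import Data.Bool using (true; false; _∧_)
open import Data.Bool.Properties using (⇔→≡)
open import Data.Vec using (Vec; []; _∷_; map)
open import Data.Vec.Relation.Unary.All as All using (All; []; _∷_)
open import Data.Vec.Relation.Unary.All.Properties as All using ()
open import Data.Vec.Relation.Binary.Pointwise.Inductive as Pointwise using (Pointwise; []; _∷_)
open import Data.Product using (_×_; _,_; proj₁; proj₂)
open import Data.Sum using (_⊎_; inj₁; inj₂)
open import Data.Empty using (⊥; ⊥-elim)
open import Function using (_∘_; id)
open import Function.Bundles using (_⇔_; mk⇔; Equivalence)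
open import Level using (0ℓ)
open import Relation.Nullary using (¬_; yes; no)
open import Relation.Binary.Core using (Rel; REL)
open import Relation.Binary.Definitions using (DecidableEquality)
open import Relation.Binary.PropositionalEquality
open import Relation.Binary.Construct.Closure.Transitive as Transitive using (TransClosure; [_]; _∷_)

Arc-irreflexive : ∀ {n} (G : OrientedGraph n) {a} → ¬ Arc G a a
Arc-irreflexive G {a} r with trans (sym (irrefl G a)) r
... | ()

Arc-asymmetric : ∀ {n} (G : OrientedGraph n) {a b} → Arc G a b → ¬ Arc G b a
Arc-asymmetric G {a} {b} r r′ with trans (sym (asym G a b r)) r′
... | ()

InducedAlong : ∀ {m n} → (Fin m → Fin n) → OrientedGraph m → OrientedGraph n → Set
InducedAlong f E F = ∀ x y → adj E x y ≡ adj F (f x) (f y)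

deleteVertex-induced : ∀ {n} (D : OrientedGraph (suc n)) v → InducedAlong (punchIn v) (deleteVertex D v) D
deleteVertex-induced D v _ _ = refl

module _ {m n} {f : Fin m → Fin n} where

  invert-induced : ∀ {E F} {Y : Subset m} {X : Subset n} →
                   InducedAlong f E F → Y ≗ X ∘ f → InducedAlong f (invert E Y) (invert F X)
  invert-induced {X = X} E⊆F Y≗X∘f x y rewrite Y≗X∘f x | Y≗X∘f y with X (f x) ∧ X (f y)
  ... | true  = E⊆F y x
  ... | false = E⊆F x y

  invertAll-induced : ∀ {k E F} {Ys : Vec (Subset m) k} {Xs : Vec (Subset n) k} →
                      InducedAlong f E F → Pointwise (λ Y X → Y ≗ X ∘ f) Ys Xs →
                      InducedAlong f (invertAll E Ys) (invertAll F Xs)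
  invertAll-induced E⊆F []               = E⊆F
  invertAll-induced {E = E} {F} {Xs = X ∷ _} E⊆F (Y≗X∘f ∷ Ys≈Xs) =
    invertAll-induced (invert-induced {E} {F} {X = X} E⊆F Y≗X∘f) Ys≈Xs

  acyclic-induced : ∀ E F → InducedAlong f E F → Acyclic F → Acyclic E
  acyclic-induced E F E⊆F acyclic x cycle =
    acyclic (f x) (Equivalence.to Transitive.equivalent
                    (Transitive.map arc (Equivalence.from Transitive.equivalent cycle)))
    where
    arc : ∀ {a b} → Arc E a b → Arc F (f a) (f b)
    arc {a} {b} = trans (sym (E⊆F a b))

map-pointwise : ∀ {A B : Set} {R : REL A B 0ℓ} {k} (g : B → A) →
                (∀ y → R (g y) y) → (ys : Vec B k) → Pointwise R (map g ys) ys
map-pointwise g R-g []       = []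
map-pointwise g R-g (y ∷ ys) = R-g y ∷ map-pointwise g R-g ys

module _ {A B : Set} {R : Rel A 0ℓ} {S : Rel B 0ℓ} (c : A → B) (_≟ᴮ_ : DecidableEquality B)
         (arc : ∀ {a b} → R a b → c a ≢ c b → S (c a) (c b))
         (no-contracted-pair : ∀ {a b d} → R a b → R b d → c a ≡ c b → c b ≡ c d → ⊥) where

  contract : ∀ {a d} → TransClosure R a d → TransClosure S (c a) (c d) ⊎ (c a ≡ c d × R a d)
  contract {a} {d} [ r ] with c a ≟ᴮ c d
  ... | yes ca≡cd = inj₂ (ca≡cd , r)
  ... | no  ca≢cd = inj₁ [ arc r ca≢cd ]
  contract {a} {d} (_∷_ {y = b} r walk) with c a ≟ᴮ c b | contract walk
  ... | no  ca≢cb | inj₁ walk′         = inj₁ (arc r ca≢cb ∷ walk′)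
  ... | no  ca≢cb | inj₂ (cb≡cd , _)  = inj₁ [ subst (S (c a)) cb≡cd (arc r ca≢cb) ]
  ... | yes ca≡cb | inj₁ walk′         = inj₁ (subst (λ z → TransClosure S z (c d)) (sym ca≡cb) walk′)
  ... | yes ca≡cb | inj₂ (cb≡cd , r′) = ⊥-elim (no-contracted-pair r r′ ca≡cb cb≡cd)

  acyclic-contraction : (∀ {a} → ¬ R a a) → (∀ b → ¬ TransClosure S b b) → ∀ a → ¬ TransClosure R a a
  acyclic-contraction irreflexive acyclic a cycle with contract cycle
  ... | inj₁ cycle′  = acyclic (c a) cycle′
  ... | inj₂ (_ , r) = irreflexive r

SameArcs : ∀ {n} → OrientedGraph n → Fin n → Fin n → Set
SameArcs G u v = ∀ w → w ≢ u → w ≢ v → adj G u w ≡ adj G v w × adj G w u ≡ adj G w v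

twins⇒sameArcs : ∀ {n} {D : OrientedGraph n} {u v} → Twins D u v → SameArcs D u v
twins⇒sameArcs {u = u} {v} (_ , out , in′) w w≢u w≢v = ⇔→≡ (strip (out w)) , ⇔→≡ (strip (in′ w))
  where
  strip : ∀ {P Q} → (P × w ≢ v) ⇔ (Q × w ≢ u) → P ⇔ Q
  strip P⇔Q = mk⇔ (λ p → proj₁ (Equivalence.to P⇔Q (p , w≢v)))
                  (λ q → proj₁ (Equivalence.from P⇔Q (q , w≢u)))

invert-sameArcs : ∀ {n} {G : OrientedGraph n} {u v} {X : Subset n} →
                  X u ≡ X v → SameArcs G u v → SameArcs (invert G X) u v
invert-sameArcs {v = v} {X} Xu≡Xv same w w≢u w≢v with same w w≢u w≢v
... | out , in′ rewrite Xu≡Xv with X v | X w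
... | true  | true  = in′ , out
... | true  | false = out , in′
... | false | true  = out , in′
... | false | false = out , in′

invertAll-sameArcs : ∀ {n k} {G : OrientedGraph n} {u v} {Xs : Vec (Subset n) k} →
                     All (λ X → X u ≡ X v) Xs → SameArcs G u v → SameArcs (invertAll G Xs) u v
invertAll-sameArcs []               same = same
invertAll-sameArcs {G = G} {Xs = X ∷ _} (Xu≡Xv ∷ agree) same =
  invertAll-sameArcs agree (invert-sameArcs {G = G} {X = X} Xu≡Xv same)

module Merge {m} {u v : Fin (suc m)} (u≢v : u ≢ v) where

  merge : Fin (suc m) → Fin (suc m)
  merge w with w ≟ v
  ... | yes _ = u
  ... | no  _ = w

  v≢merge : ∀ w → v ≢ merge w
  v≢merge w with w ≟ v
  ... | yes _   = u≢v ∘ sym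
  ... | no  w≢v = w≢v ∘ sym

  merge-u : merge u ≡ u
  merge-u with u ≟ v
  ... | yes u≡v = ⊥-elim (u≢v u≡v)
  ... | no  _   = refl

  merge-v : merge v ≡ u
  merge-v with v ≟ v
  ... | yes _   = refl
  ... | no  v≢v = ⊥-elim (v≢v refl)

  merge-punchIn : ∀ x → merge (punchIn v x) ≡ punchIn v x
  merge-punchIn x with punchIn v x ≟ v
  ... | yes p≡v = ⊥-elim (punchInᵢ≢i v x p≡v)
  ... | no  _   = refl

  merge-collision : ∀ {a b d} → merge a ≡ merge b → merge b ≡ merge d → a ≡ b ⊎ b ≡ d ⊎ a ≡ d
  merge-collision {a} {b} {d} e e′ with a ≟ v | b ≟ v | d ≟ v
  ... | yes a≡v | yes b≡v | _       = inj₁ (trans a≡v (sym b≡v))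
  ... | _       | yes b≡v | yes d≡v = inj₂ (inj₁ (trans b≡v (sym d≡v)))
  ... | yes a≡v | no  _   | yes d≡v = inj₂ (inj₂ (trans a≡v (sym d≡v)))
  ... | no  _   | no  _   | _       = inj₁ e
  ... | _       | no  _   | no  _   = inj₂ (inj₁ e′)
  ... | no  _   | yes _   | no  _   = inj₂ (inj₂ (trans e e′))

  merge-arc : ∀ {G : OrientedGraph (suc m)} → SameArcs G u v →
              ∀ {a b} → Arc G a b → merge a ≢ merge b → Arc G (merge a) (merge b)
  merge-arc {G} same {a} {b} r ma≢mb with a ≟ v | b ≟ v
  ... | yes _   | yes _   = ⊥-elim (ma≢mb refl)
  ... | yes a≡v | no  b≢v = trans (proj₁ (same b (ma≢mb ∘ sym) b≢v)) (subst (λ z → Arc G z b) a≡v r)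
  ... | no  a≢v | yes b≡v = trans (proj₂ (same a ma≢mb a≢v)) (subst (Arc G a) b≡v r)
  ... | no  _   | no  _   = r

  collapse : Fin (suc m) → Fin m
  collapse w = punchOut (v≢merge w)

  punchIn-collapse : ∀ w → punchIn v (collapse w) ≡ merge w
  punchIn-collapse w = punchIn-punchOut (v≢merge w)

  collapse-punchIn : ∀ x → collapse (punchIn v x) ≡ x
  collapse-punchIn x = trans (punchOut-cong v (merge-punchIn x)) (punchOut-punchIn v)

  collapse-u≡collapse-v : collapse u ≡ collapse v
  collapse-u≡collapse-v = punchOut-cong v (trans merge-u (sym merge-v))

  collapse-≡⇒merge-≡ : ∀ {a b} → collapse a ≡ collapse b → merge a ≡ merge b
  collapse-≡⇒merge-≡ {a} {b} = punchOut-injective (v≢merge a) (v≢merge b)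

acyclic-deleteTwin⇒acyclic : ∀ {m} (G : OrientedGraph (suc m)) {u v} → u ≢ v → SameArcs G u v →
                             Acyclic (deleteVertex G v) → Acyclic G
acyclic-deleteTwin⇒acyclic G {v = v} u≢v same =
  acyclic-contraction collapse _≟_ arc no-contracted-pair (Arc-irreflexive G)
  where
  open Merge u≢v

  arc : ∀ {a b} → Arc G a b → collapse a ≢ collapse b →
        Arc (deleteVertex G v) (collapse a) (collapse b)
  arc {a} {b} r ca≢cb =
    subst₂ (Arc G) (sym (punchIn-collapse a)) (sym (punchIn-collapse b))
      (merge-arc {G} same r (ca≢cb ∘ punchOut-cong v))

  no-contracted-pair : ∀ {a b d} → Arc G a b → Arc G b d →
                       collapse a ≡ collapse b → collapse b ≡ collapse d → ⊥
  no-contracted-pair {a} {b} {d} r r′ e e′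
    with merge-collision {a} {b} {d} (collapse-≡⇒merge-≡ {a} {b} e)
                                     (collapse-≡⇒merge-≡ {b} {d} e′)
  ... | inj₁ refl        = Arc-irreflexive G r
  ... | inj₂ (inj₁ refl) = Arc-irreflexive G r′
  ... | inj₂ (inj₂ refl) = Arc-asymmetric G r r′

deleteVertex-invertible : ∀ {n} (D : OrientedGraph (suc n)) v {j} →
                          InvertibleWith D j → InvertibleWith (deleteVertex D v) j
deleteVertex-invertible D v (Xs , acyclic) =
  Ys , acyclic-induced (invertAll (deleteVertex D v) Ys) (invertAll D Xs) induced acyclic
  where
  Ys : Vec (Subset _) _
  Ys = map (_∘ punchIn v) Xs

  induced : InducedAlong (punchIn v) (invertAll (deleteVertex D v) Ys) (invertAll D Xs)
  induced = invertAll-induced {F = D} (deleteVertex-induced D v)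
                              (map-pointwise (_∘ punchIn v) (λ _ _ → refl) Xs)

deleteTwin-invertible : ∀ {n} (D : OrientedGraph (suc n)) {u v} → Twins D u v → ∀ {j} →
                        InvertibleWith (deleteVertex D v) j → InvertibleWith D j
deleteTwin-invertible D {u} {v} twins@(u≢v , _) (Ys , acyclic) =
  Xs , acyclic-deleteTwin⇒acyclic G u≢v same acyclic′
  where
  open Merge u≢v

  Xs : Vec (Subset (suc _)) _
  Xs = map (_∘ collapse) Ys

  G : OrientedGraph (suc _)
  G = invertAll D Xs

  same : SameArcs G u v
  same = invertAll-sameArcs (All.map⁺ (All.universal (λ Y → cong Y collapse-u≡collapse-v) Ys))
                            (twins⇒sameArcs {D = D} twins)

  restrictions : Pointwise (λ Y X → Y ≗ X ∘ punchIn v) Ys Xs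
  restrictions = Pointwise.sym id
    (map-pointwise (_∘ collapse) (λ Y x → cong Y (sym (collapse-punchIn x))) Ys)

  induced : InducedAlong (punchIn v) (invertAll (deleteVertex D v) Ys) G
  induced = invertAll-induced {F = D} (deleteVertex-induced D v) restrictions

  acyclic′ : Acyclic (deleteVertex G v)
  acyclic′ = acyclic-induced (deleteVertex G v) (invertAll (deleteVertex D v) Ys)
                             (λ x y → sym (induced x y)) acyclic

same-invertibility⇒same-inversionNumber :
  ∀ {m n} {E : OrientedGraph m} {F : OrientedGraph n} →
  (∀ {j} → InvertibleWith E j → InvertibleWith F j) → (∀ {j} → InvertibleWith F j → InvertibleWith E j) →
  ∀ k → IsInversionNumber E k ⇔ IsInversionNumber F k
same-invertibility⇒same-inversionNumber E⇒F F⇒E k =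
  mk⇔ (λ (invertible , minimal) → E⇒F invertible , λ j → minimal j ∘ F⇒E)
      (λ (invertible , minimal) → F⇒E invertible , λ j → minimal j ∘ E⇒F)

proposition2p5 : (n : ℕ) → 1 ≤ n → (D : OrientedGraph (suc n)) → (u v : Fin (suc n)) →
                 Twins D u v →
                 (k : ℕ) → IsInversionNumber (deleteVertex D v) k ⇔ IsInversionNumber D k
proposition2p5 n _ D u v twins =
  same-invertibility⇒same-inversionNumber (deleteTwin-invertible D twins) (deleteVertex-invertible D v)
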